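{- Let $n\ge 1$ be an integer and $\alpha,\beta\in(0,1]$. Consider the $n$-site open-boundary TASEP, the continuous-time Markov chain on $\{\bullet,\circ\}^n$ with transition rates $W(\mathcal{C}\to\mathcal{C}')$ described in the context. For $\mathcal{C}\in\{\bullet,\circ\}^n$ define $$\mathbb{P}^{\mathrm{st}}_n\{\mathcal{C}\} = Z_n^{ -1}\sum_{T\in R^{ -1}\{\mathcal{C}\}}\mu(T),\qquad Z_n=\sum_{T\in\mathcal{T}_n}\mu(T),$$ where $\mu(T)=\alpha^{ -l(T)}\beta^{ -r(T)}$. Then $\mathbb{P}^{\mathrm{st}}_n$ is the stationary measure of this chain; that is, for every $\mathcal{C}\in\{\bullet,\circ\}^n$, $$\mathbb{P}^{\mathrm{st}}_n\{\mathcal{C}\}\sum_{\mathcal{C}'}W(\mathcal{C}\to\mathcal{C}') = \sum_{\mathcal{C}'}\mathbb{P}^{\mathrm{st}}_n\{\mathcal{C}'\}\,W(\mathcal{C}'\to\mathcal{C}).$$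
   Context: Configurations are strings $\mathcal{C}\in\{\bullet,\circ\}^n$ (particle occupancies of $n$ sites). Transition rates: $W(\mathcal{C}\to\mathcal{C}')=\alpha$ if $\mathcal{C}=\circ\mathcal{A}$ and $\mathcal{C}'=\bullet\mathcal{A}$; $=\beta$ if $\mathcal{C}=\mathcal{A}\bullet$ and $\mathcal{C}'=\mathcal{A}\circ$; $=1$ if $\mathcal{C}=\mathcal{A}\bullet\circ\mathcal{A}'$ and $\mathcal{C}'=\mathcal{A}\circ\bullet\mathcal{A}'$; $=0$ otherwise, where $\mathcal{A},\mathcal{A}'$ are arbitrary (possibly empty) strings over $\{\bullet,\circ\}$. A plane binary tree is a rooted tree in which every vertex is either an endpoint (leaf) or has exactly two children, an ordered left child and right child. $\mathcal{T}_n$ denotes the set of plane binary trees with $n+2$ endpoints; the endpoints are ordered from left to right. A non-root vertex is a left (resp. right) descendent if it is the left (resp. right) child of its parent. The reduction map $R:\mathcal{T}_n\to\{\bullet,\circ\}^n$ sends $T$ to $(t_1,\dots,t_n)$, where $t_k=\bullet$ if the $(k+1)$-th endpoint of $T$ from the left is a left descendent and $t_k=\circ$ if it is a right descendent. $l(T)$ (resp. $r(T)$) is the number of vertices strictly between the leftmost (resp. rightmost) endpoint and the root on the path joining them (neither the endpoint nor the root is counted).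
   Formalization: The parameters α and β range over the rationals in (0,1]. -}

module Defs where

open import Data.Bool using (Bool; true; false; if_then_else_; _∧_; _∨_; not)
open import Data.Nat using (ℕ; zero; suc; _∸_) renaming (_≟_ to _≟ℕ_)
open import Data.List using (List; []; _∷_; _++_; concatMap; map; foldr; filter; length)
open import Data.List.Properties using (≡-dec)
open import Data.Vec using (Vec; toList) renaming ([] to []ᵥ; _∷_ to _∷ᵥ_)
open import Data.Rational using (ℚ; 0ℚ; 1ℚ; _+_; _*_; 1/_; ≢-nonZero; _≟_)
open import Relation.Nullary using (yes; no)
open import Relation.Nullary.Decidable using (⌊_⌋)
import Data.Bool as B
open import Data.Nat using () renaming (_+_ to _ℕ+_)

-- Configurations: true = ● (occupied), false = ○ (empty).
Config : ℕ → Set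
Config n = Vec Bool n

allConfigs : (n : ℕ) → List (Config n)
allConfigs zero = []ᵥ ∷ []
allConfigs (suc n) = concatMap (λ v → (true ∷ᵥ v) ∷ (false ∷ᵥ v) ∷ []) (allConfigs n)

_==_ : List Bool → List Bool → Bool
a == b = ⌊ ≡-dec B._≟_ a b ⌋

isIn : List Bool → List Bool → Bool
isIn (false ∷ a) (true ∷ a') = a == a'
isIn _ _ = false

-- C = A●, C' = A○
isOut : List Bool → List Bool → Bool
isOut (true ∷ []) (false ∷ []) = true
isOut (x ∷ xs@(_ ∷ _)) (y ∷ ys) = ⌊ B._≟_ x y ⌋ ∧ isOut xs ys
isOut _ _ = false

-- C = A●○A', C' = A○●A'
isHop : List Bool → List Bool → Bool
isHop (true ∷ false ∷ a) (false ∷ true ∷ a') = a == a'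
isHop (x ∷ xs) (y ∷ ys) = ⌊ B._≟_ x y ⌋ ∧ isHop xs ys
isHop _ _ = false

W : (α β : ℚ) {n : ℕ} → Config n → Config n → ℚ
W α β C C' =
  if isIn (toList C) (toList C') then α
  else if isOut (toList C) (toList C') then β
  else if isHop (toList C) (toList C') then 1ℚ
  else 0ℚ

Σ[_]_ : {A : Set} → List A → (A → ℚ) → ℚ
Σ[ xs ] f = foldr (λ x s → f x + s) 0ℚ xs

-- multiplicative inverse, total (1/q for q ≠ 0, and 0 for q = 0)
inv : ℚ → ℚ
inv q with q ≟ 0ℚ
... | yes _ = 0ℚ
... | no q≢0 = 1/_ q {{≢-nonZero q≢0}}

_^_ : ℚ → ℕ → ℚ
q ^ zero = 1ℚ
q ^ suc k = q * (q ^ k)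

data Tree : Set where
  leaf : Tree
  node : Tree → Tree → Tree

leaves : Tree → ℕ
leaves leaf = 1
leaves (node l r) = leaves l ℕ+ leaves r

-- all plane binary trees of depth at most d (each listed exactly once)
treesDepth : ℕ → List Tree
treesDepth zero = leaf ∷ []
treesDepth (suc d) = leaf ∷ concatMap (λ l → map (node l) (treesDepth d)) (treesDepth d)

-- 𝒯ₙ : all plane binary trees with n + 2 endpoints
-- (such a tree has depth ≤ n + 1, so it occurs in treesDepth (n + 2))
𝒯 : ℕ → List Tree
𝒯 n = filter (λ T → leaves T ≟ℕ suc (suc n)) (treesDepth (suc (suc n)))

-- left/right descendent flags of the endpoints, left to right;
-- the first argument is the flag of the current vertex (true = left descendent)
flags : Bool → Tree → List Bool
flags d leaf = d ∷ []
flags d (node l r) = flags true l ++ flags false r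

-- reduction map R : drop the leftmost and rightmost endpoints;
-- ● (true) for a left descendent, ○ (false) for a right descendent
dropLast : List Bool → List Bool
dropLast [] = []
dropLast (x ∷ []) = []
dropLast (x ∷ y ∷ xs) = x ∷ dropLast (y ∷ xs)

R : Tree → List Bool
R leaf = []
R (node l r) = dropLastFirst (flags true l ++ flags false r)
  where
  dropLastFirst : List Bool → List Bool
  dropLastFirst [] = []
  dropLastFirst (_ ∷ xs) = dropLast xs

depthL depthR : Tree → ℕ
depthL leaf = 0
depthL (node l r) = suc (depthL l)
depthR leaf = 0
depthR (node l r) = suc (depthR r)

-- l(T), r(T): vertices strictly between the leftmost/rightmost endpoint and the root
lT rT : Tree → ℕ
lT T = depthL T ∸ 1
rT T = depthR T ∸ 1

μ : (α β : ℚ) → Tree → ℚ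
μ α β T = (inv α ^ lT T) * (inv β ^ rT T)

Z : (α β : ℚ) → ℕ → ℚ
Z α β n = Σ[ 𝒯 n ] μ α β

weight : (α β : ℚ) {n : ℕ} → Config n → ℚ
weight α β {n} C = Σ[ filter (λ T → ≡-dec B._≟_ (R T) (toList C)) (𝒯 n) ] μ α β

Pst : (α β : ℚ) {n : ℕ} → Config n → ℚ
Pst α β {n} C = inv (Z α β n) * weight α β C

{-# OPTIONS --safe #-}
-- Let f(w) be the total μ-weight of the trees reducing to w. Replacing the k-th endpoint by a cherry
-- maps the trees whose sequence of endpoint flags is P x B (x = ● or ○, |P| = k) bijectively onto the
-- trees with flags P●○B, since two consecutive endpoints flagged ●○ are always sibling leaves; and it
-- changes l(T) or r(T) only when the replaced endpoint is the leftmost or the rightmost one. Hence f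
-- obeys the relations of the matrix-product ansatz
--   f(u●○v) = f(u●v) + f(u○v),   f(○v) = α⁻¹ f(v),   f(u●) = β⁻¹ f(u).
-- Any such f is stationary: in f(C)·(outflow rate) − (inflow), the bulk hops leave a telescoping sum
-- of "hat" terms ±f(C with its first or last site deleted), − for ● and + for ○, and its two ends
-- are cancelled by the entry term at the left boundary and the exit term at the right one.
module Submission where

open import Defs
open import Data.Bool as Bool using (Bool; true; false; _∧_; if_then_else_)
open import Data.List using (List; []; _∷_; _++_; length; map; filter; concatMap; foldr; null; cartesianProductWith)
open import Data.List.Properties
  using ( ≡-dec; foldr-map; filter-none; filter-≐; ++-assoc; ++-cancelˡ; length-++; length-++-sucʳ; length-++-comm
        ; ∷-injective; ∷-injectiveˡ; ∷-injectiveʳ; ∷ʳ-injectiveˡ; ∷ʳ-injectiveʳ)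
open import Data.List.Membership.Propositional using (_∈_)
open import Data.List.Membership.Propositional.Properties
  using (∈-map⁺; ∈-map⁻; ∈-filter⁺; ∈-filter⁻; ∈-cartesianProductWith⁺; ∈-cartesianProductWith⁻)
import Data.List.Relation.Unary.All as All
open import Data.List.Relation.Unary.AllPairs using ([]; _∷_)
open import Data.List.Relation.Unary.Unique.Propositional using (Unique)
import Data.List.Relation.Unary.Unique.Propositional.Properties as Unique
open import Data.List.Relation.Unary.Any using (here; there)
open import Data.List.Relation.Binary.Permutation.Propositional using (_↭_; ↭⇒↭ₛ)
open import Data.List.Relation.Binary.BagAndSetEquality using (∼bag⇒↭)
open import Data.List.Membership.Propositional.Properties.WithK using (unique∧set⇒bag)
open import Data.List.Relation.Binary.Permutation.Propositional.Properties using (map⁺)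
import Data.List.Relation.Binary.Permutation.Setoid.Properties as Permutationₛ
open import Data.Nat as ℕ using (ℕ; zero; suc; _≥_; _∸_)
import Data.Nat.Properties as ℕ
open import Data.Rational using (ℚ; 0ℚ; 1ℚ; _+_; _*_; -_; _-_; _<_; _≤_; _≟_; ≢-nonZero)
open import Data.Rational.Properties
  using ( +-identityˡ; +-identityʳ; +-assoc; +-comm; *-zeroʳ; *-identityˡ; *-identityʳ; *-assoc; *-distribˡ-+
        ; *-inverseʳ; <⇒≢; +-0-isCommutativeMonoid)
open import Data.Rational.Solver using (module +-*-Solver)
open import Data.Vec using (toList) renaming (_∷_ to _∷ᵥ_)
open import Data.Vec.Properties using (length-toList)
open import Function using (_∘_; case_of_; mk⇔)
open import Relation.Binary.PropositionalEquality
open import Relation.Nullary.Decidable using (does; isYes≗does; yes; no)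
open import Relation.Nullary.Negation using (contradiction)
open import Relation.Unary using (Decidable)
open import Relation.Unary.Properties using (_∪?_)
open import Data.Empty using (⊥; ⊥-elim)
open import Data.Product using (∃-syntax; _×_; _,_; proj₁; proj₂)
open import Data.Sum using (_⊎_; inj₁; inj₂)

open +-*-Solver using (solve; _:+_; _:*_; _:-_; _:=_; con)
open ≡-Reasoning

module _ {A : Set} where

  Σ-cong-∈ : (xs : List A) {g h : A → ℚ} → (∀ {x} → x ∈ xs → g x ≡ h x) → Σ[ xs ] g ≡ Σ[ xs ] h
  Σ-cong-∈ []       _ = refl
  Σ-cong-∈ (x ∷ xs) e = cong₂ _+_ (e (here refl)) (Σ-cong-∈ xs (e ∘ there))

  Σ-cong : (xs : List A) {g h : A → ℚ} → (∀ x → g x ≡ h x) → Σ[ xs ] g ≡ Σ[ xs ] h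
  Σ-cong xs e = Σ-cong-∈ xs (λ {x} _ → e x)

  Σ-zero : (xs : List A) → Σ[ xs ] (λ _ → 0ℚ) ≡ 0ℚ
  Σ-zero []       = refl
  Σ-zero (x ∷ xs) = trans (+-identityˡ _) (Σ-zero xs)

  Σ-distrib-+ : (xs : List A) (g h : A → ℚ) → Σ[ xs ] (λ x → g x + h x) ≡ Σ[ xs ] g + Σ[ xs ] h
  Σ-distrib-+ []       g h = refl
  Σ-distrib-+ (x ∷ xs) g h = trans (cong (g x + h x +_) (Σ-distrib-+ xs g h))
    (solve 4 (λ a b c d → (a :+ b) :+ (c :+ d) := (a :+ c) :+ (b :+ d)) refl (g x) (h x) (Σ[ xs ] g) (Σ[ xs ] h))

  *-distribˡ-Σ : (k : ℚ) (xs : List A) (g : A → ℚ) → k * Σ[ xs ] g ≡ Σ[ xs ] (λ x → k * g x)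
  *-distribˡ-Σ k []       g = *-zeroʳ k
  *-distribˡ-Σ k (x ∷ xs) g = trans
    (solve 3 (λ k a b → k :* (a :+ b) := k :* a :+ k :* b) refl k (g x) (Σ[ xs ] g))
    (cong (k * g x +_) (*-distribˡ-Σ k xs g))

  Σ-++ : (xs ys : List A) (g : A → ℚ) → Σ[ xs ++ ys ] g ≡ Σ[ xs ] g + Σ[ ys ] g
  Σ-++ []       ys g = sym (+-identityˡ _)
  Σ-++ (x ∷ xs) ys g = trans (cong (g x +_) (Σ-++ xs ys g))
    (solve 3 (λ a b c → a :+ (b :+ c) := (a :+ b) :+ c) refl (g x) (Σ[ xs ] g) (Σ[ ys ] g))

  Σ-↭ : {xs ys : List A} (g : A → ℚ) → xs ↭ ys → Σ[ xs ] g ≡ Σ[ ys ] g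
  Σ-↭ {xs} {ys} g p = begin
    Σ[ xs ] g                ≡⟨ foldr-map _+_ g 0ℚ xs ⟨
    foldr _+_ 0ℚ (map g xs)  ≡⟨ foldr-commMonoid +-0-isCommutativeMonoid (↭⇒↭ₛ (map⁺ g p)) ⟩
    foldr _+_ 0ℚ (map g ys)  ≡⟨ foldr-map _+_ g 0ℚ ys ⟩
    Σ[ ys ] g                ∎
    where open Permutationₛ (setoid ℚ) using (foldr-commMonoid)

Σ-map : {A B : Set} (f : A → B) (xs : List A) (g : B → ℚ) → Σ[ map f xs ] g ≡ Σ[ xs ] (g ∘ f)
Σ-map f []       g = refl
Σ-map f (x ∷ xs) g = cong (g (f x) +_) (Σ-map f xs g)

Σ-concatMap : {A B : Set} (k : A → List B) (xs : List A) (g : B → ℚ) →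
  Σ[ concatMap k xs ] g ≡ Σ[ xs ] (λ x → Σ[ k x ] g)
Σ-concatMap k []       g = refl
Σ-concatMap k (x ∷ xs) g = trans (Σ-++ (k x) (concatMap k xs) g) (cong (Σ[ k x ] g +_) (Σ-concatMap k xs g))

Σ-reindex : {A B : Set} {xs : List A} {ys : List B} (f : A → B) (g : B → ℚ) →
  Unique xs → Unique ys → (∀ {x y} → f x ≡ f y → x ≡ y) →
  (∀ {x} → x ∈ xs → f x ∈ ys) → (∀ {y} → y ∈ ys → ∃[ x ] x ∈ xs × y ≡ f x) →
  Σ[ ys ] g ≡ Σ[ xs ] (g ∘ f)
Σ-reindex {xs = xs} {ys} f g xs! ys! f-injective into onto = trans (Σ-↭ g ys↭) (Σ-map f xs g)
  where
  to : ∀ {y} → y ∈ ys → y ∈ map f xs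
  to y∈ with x , x∈ , refl ← onto y∈ = ∈-map⁺ f x∈
  from : ∀ {y} → y ∈ map f xs → y ∈ ys
  from y∈ with x , x∈ , refl ← ∈-map⁻ f y∈ = into x∈
  ys↭ : ys ↭ map f xs
  ys↭ = ∼bag⇒↭ (unique∧set⇒bag ys! (Unique.map⁺ f-injective xs!) (mk⇔ to from))

Σ-filter-⊎ : {A : Set} {P Q : A → Set} (P? : Decidable P) (Q? : Decidable Q) →
  (∀ {x} → P x → Q x → ⊥) → (xs : List A) (g : A → ℚ) →
  Σ[ filter (P? ∪? Q?) xs ] g ≡ Σ[ filter P? xs ] g + Σ[ filter Q? xs ] g
Σ-filter-⊎ P? Q? disjoint []       g = sym (+-identityʳ 0ℚ)
Σ-filter-⊎ P? Q? disjoint (x ∷ xs) g with P? x | Q? x | Σ-filter-⊎ P? Q? disjoint xs g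
... | yes p | yes q | _  = ⊥-elim (disjoint p q)
... | yes _ | no  _ | ih = trans (cong (g x +_) ih) (sym (+-assoc (g x) _ _))
... | no  _ | yes _ | ih = trans (cong (g x +_) ih)
  (solve 3 (λ a b c → a :+ (b :+ c) := b :+ (a :+ c)) refl (g x) (Σ[ filter P? xs ] g) (Σ[ filter Q? xs ] g))
... | no  _ | no  _ | ih = ih

drop-*0ˡ : ∀ a b → a * 0ℚ + b ≡ b
drop-*0ˡ a b = trans (cong (_+ b) (*-zeroʳ a)) (+-identityˡ b)

drop-*0ʳ : ∀ a b → b + a * 0ℚ ≡ b
drop-*0ʳ a b = trans (cong (b +_) (*-zeroʳ a)) (+-identityʳ b)

configs : ℕ → List (List Bool)
configs n = map toList (allConfigs n)

ΣConfig : ℕ → (List Bool → ℚ) → ℚ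
ΣConfig n F = Σ[ configs n ] F

ΣConfig-cong : ∀ n {F G : List Bool → ℚ} → (∀ l → F l ≡ G l) → ΣConfig n F ≡ ΣConfig n G
ΣConfig-cong n = Σ-cong (configs n)

ΣConfig-suc : ∀ n (F : List Bool → ℚ) →
  ΣConfig (suc n) F ≡ ΣConfig n (λ l → F (true ∷ l) + F (false ∷ l))
ΣConfig-suc n F = begin
  Σ[ configs (suc n) ] F                  ≡⟨ Σ-map toList (allConfigs (suc n)) F ⟩
  Σ[ allConfigs (suc n) ] (F ∘ toList)    ≡⟨ Σ-concatMap _ (allConfigs n) (F ∘ toList) ⟩
  Σ[ allConfigs n ] (λ C → F (true ∷ toList C) + (F (false ∷ toList C) + 0ℚ))
    ≡⟨ Σ-cong (allConfigs n) (λ C → cong (F (true ∷ toList C) +_) (+-identityʳ _)) ⟩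
  Σ[ allConfigs n ] (λ C → F (true ∷ toList C) + F (false ∷ toList C))
    ≡⟨ Σ-map toList (allConfigs n) (λ l → F (true ∷ l) + F (false ∷ l)) ⟨
  ΣConfig n (λ l → F (true ∷ l) + F (false ∷ l)) ∎

ΣConfig-zero : ∀ n {F : List Bool → ℚ} → (∀ l → F l ≡ 0ℚ) → ΣConfig n F ≡ 0ℚ
ΣConfig-zero n e = trans (ΣConfig-cong n e) (Σ-zero (configs n))

-- isOut and isHop only compute once the summation variable is known to have at least two sites.
ΣConfig-peel : ∀ n (F G : List Bool → ℚ) → (∀ x l → F (true ∷ x ∷ l) + F (false ∷ x ∷ l) ≡ G (x ∷ l)) →
  ΣConfig (suc (suc n)) F ≡ ΣConfig (suc n) G
ΣConfig-peel n F G e = begin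
  ΣConfig (suc (suc n)) F                       ≡⟨ ΣConfig-suc (suc n) F ⟩
  ΣConfig (suc n) F′                            ≡⟨ Σ-map toList (allConfigs (suc n)) F′ ⟩
  Σ[ allConfigs (suc n) ] (F′ ∘ toList)         ≡⟨ Σ-cong (allConfigs (suc n)) {F′ ∘ toList} {G ∘ toList} e′ ⟩
  Σ[ allConfigs (suc n) ] (G ∘ toList)          ≡⟨ Σ-map toList (allConfigs (suc n)) G ⟨
  ΣConfig (suc n) G                             ∎
  where
  F′ : List Bool → ℚ
  F′ l = F (true ∷ l) + F (false ∷ l)
  e′ : ∀ (C : Config (suc n)) → F′ (toList C) ≡ G (toList C)
  e′ (x ∷ᵥ C) = e x (toList C)

ΣConfig-linear : ∀ n (α β : ℚ) (A B C : List Bool → ℚ) →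
  ΣConfig n (λ l → α * A l + β * B l + C l) ≡ α * ΣConfig n A + β * ΣConfig n B + ΣConfig n C
ΣConfig-linear n α β A B C = begin
  ΣConfig n (λ l → α * A l + β * B l + C l)
    ≡⟨ Σ-distrib-+ (configs n) (λ l → α * A l + β * B l) C ⟩
  ΣConfig n (λ l → α * A l + β * B l) + ΣConfig n C
    ≡⟨ cong (_+ ΣConfig n C) (Σ-distrib-+ (configs n) (λ l → α * A l) (λ l → β * B l)) ⟩
  ΣConfig n (λ l → α * A l) + ΣConfig n (λ l → β * B l) + ΣConfig n C
    ≡⟨ cong₂ (λ a b → a + b + ΣConfig n C) (*-distribˡ-Σ α (configs n) A) (*-distribˡ-Σ β (configs n) B) ⟨
  α * ΣConfig n A + β * ΣConfig n B + ΣConfig n C ∎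

𝟙 : Bool → ℚ
𝟙 true  = 1ℚ
𝟙 false = 0ℚ

==-∷ : ∀ x y (l c : List Bool) → ((x ∷ l) == (y ∷ c)) ≡ does (x Bool.≟ y) ∧ (l == c)
==-∷ x y l c = trans (isYes≗does (≡-dec Bool._≟_ (x ∷ l) (y ∷ c)))
  (cong (does (x Bool.≟ y) ∧_) (sym (isYes≗does (≡-dec Bool._≟_ l c))))

==-sym : ∀ (l c : List Bool) → (l == c) ≡ (c == l)
==-sym l c with ≡-dec Bool._≟_ l c | ≡-dec Bool._≟_ c l
... | yes _  | yes _  = refl
... | no  _  | no  _  = refl
... | yes p  | no ¬q = ⊥-elim (¬q (sym p))
... | no ¬p | yes q  = ⊥-elim (¬p (sym q))

ΣConfig-select : (c : List Bool) (F : List Bool → ℚ) →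
  ΣConfig (length c) (λ l → F l * 𝟙 (l == c)) ≡ F c
ΣConfig-select []      F = trans (+-identityʳ _) (*-identityʳ _)
ΣConfig-select (x ∷ c) F = begin
  ΣConfig (suc (length c)) (λ l → F l * 𝟙 (l == (x ∷ c)))  ≡⟨ ΣConfig-suc (length c) (λ l → F l * 𝟙 (l == (x ∷ c))) ⟩
  ΣConfig (length c) (λ l → Fx true l + Fx false l)        ≡⟨ ΣConfig-cong (length c) (select x) ⟩
  ΣConfig (length c) (λ l → F (x ∷ l) * 𝟙 (l == c))        ≡⟨ ΣConfig-select c (F ∘ (x ∷_)) ⟩
  F (x ∷ c)                                                ∎
  where
  Fx : Bool → List Bool → ℚ
  Fx y l = F (y ∷ l) * 𝟙 ((y ∷ l) == (x ∷ c))
  select : ∀ x l → F (true ∷ l) * 𝟙 ((true ∷ l) == (x ∷ c)) + F (false ∷ l) * 𝟙 ((false ∷ l) == (x ∷ c))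
                   ≡ F (x ∷ l) * 𝟙 (l == c)
  select true  l rewrite ==-∷ true true l c | ==-∷ false true l c = drop-*0ʳ (F (false ∷ l)) _
  select false l rewrite ==-∷ true false l c | ==-∷ false false l c = drop-*0ˡ (F (true ∷ l)) _

ΣConfig-count : (c : List Bool) → ΣConfig (length c) (λ l → 𝟙 (c == l)) ≡ 1ℚ
ΣConfig-count c = trans (ΣConfig-cong (length c) (λ l → trans (cong 𝟙 (==-sym c l)) (sym (*-identityˡ _))))
  (ΣConfig-select c (λ _ → 1ℚ))

-- Transition rates

rate : ℚ → ℚ → List Bool → List Bool → ℚ
rate α β l c = if isIn l c then α else if isOut l c then β else if isHop l c then 1ℚ else 0ℚ

isIn⇒¬isOut : ∀ l c → isIn l c ≡ true → isOut l c ≡ false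
isIn⇒¬isOut (false ∷ [])    (true ∷ c)  _ = refl
isIn⇒¬isOut (false ∷ _ ∷ _) (true ∷ c)  _ = refl
isIn⇒¬isOut (false ∷ _)     (false ∷ _) ()
isIn⇒¬isOut (false ∷ _)     []          ()
isIn⇒¬isOut (true ∷ _)      _           ()
isIn⇒¬isOut []              _           ()

isIn⇒¬isHop : ∀ l c → isIn l c ≡ true → isHop l c ≡ false
isIn⇒¬isHop (false ∷ _) (true ∷ _)  _ = refl
isIn⇒¬isHop (false ∷ _) (false ∷ _) ()
isIn⇒¬isHop (false ∷ _) []          ()
isIn⇒¬isHop (true ∷ _)  _           ()
isIn⇒¬isHop []          _           ()

isOut⇒¬isHop : ∀ l c → isOut l c ≡ true → isHop l c ≡ false
isOut⇒¬isHop (true ∷ [])     (false ∷ [])    _ = refl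
isOut⇒¬isHop (true ∷ [])     (false ∷ _ ∷ _) ()
isOut⇒¬isHop (true ∷ [])     (true ∷ _)      ()
isOut⇒¬isHop (true ∷ [])     []              ()
isOut⇒¬isHop (false ∷ [])    _               ()
isOut⇒¬isHop []              _               ()
isOut⇒¬isHop (true ∷ _ ∷ _)  []              ()
isOut⇒¬isHop (false ∷ _ ∷ _) []              ()
isOut⇒¬isHop (true ∷ true ∷ l)  (true ∷ c)   e = isOut⇒¬isHop (true ∷ l) c e
isOut⇒¬isHop (true ∷ false ∷ l) (true ∷ c)   e = isOut⇒¬isHop (false ∷ l) c e
isOut⇒¬isHop (false ∷ y ∷ l) (false ∷ c)     e = isOut⇒¬isHop (y ∷ l) c e
isOut⇒¬isHop (true ∷ _ ∷ _)  (false ∷ _)     ()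
isOut⇒¬isHop (false ∷ _ ∷ _) (true ∷ _)      ()

rate-decomposition : ∀ α β l c →
  rate α β l c ≡ α * 𝟙 (isIn l c) + β * 𝟙 (isOut l c) + 𝟙 (isHop l c)
rate-decomposition α β l c with isIn l c in isIn≡ | isOut l c in isOut≡ | isHop l c in isHop≡
... | true  | true  | _     with () ← trans (sym isOut≡) (isIn⇒¬isOut l c isIn≡)
... | true  | false | true  with () ← trans (sym isHop≡) (isIn⇒¬isHop l c isIn≡)
... | false | true  | true  with () ← trans (sym isHop≡) (isOut⇒¬isHop l c isOut≡)
... | true  | false | false = solve 2 (λ α β → α := α :* con 1ℚ :+ β :* con 0ℚ :+ con 0ℚ) refl α β
... | false | true  | false = solve 2 (λ α β → β := α :* con 0ℚ :+ β :* con 1ℚ :+ con 0ℚ) refl α β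
... | false | false | true  = solve 2 (λ α β → con 1ℚ := α :* con 0ℚ :+ β :* con 0ℚ :+ con 1ℚ) refl α β
... | false | false | false = solve 2 (λ α β → con 0ℚ := α :* con 0ℚ :+ β :* con 0ℚ :+ con 0ℚ) refl α β

#entries : List Bool → ℚ
#entries (false ∷ _) = 1ℚ
#entries _           = 0ℚ

#exits : List Bool → ℚ
#exits []              = 0ℚ
#exits (x ∷ [])        = 𝟙 x
#exits (_ ∷ c@(_ ∷ _)) = #exits c

#hops : List Bool → ℚ
#hops []                 = 0ℚ
#hops (true ∷ false ∷ c) = 1ℚ + #hops (false ∷ c)
#hops (true ∷ true ∷ c)  = #hops (true ∷ c)
#hops (true ∷ [])        = 0ℚ
#hops (false ∷ c)        = #hops c

ΣConfig-isIn-from : ∀ c → ΣConfig (length c) (𝟙 ∘ isIn c) ≡ #entries c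
ΣConfig-isIn-from []          = +-identityʳ 0ℚ
ΣConfig-isIn-from (true ∷ c)  = Σ-zero (configs (suc (length c)))
ΣConfig-isIn-from (false ∷ c) = trans (ΣConfig-suc (length c) (𝟙 ∘ isIn (false ∷ c)))
  (trans (ΣConfig-cong (length c) (λ l → +-identityʳ (𝟙 (c == l)))) (ΣConfig-count c))

ΣConfig-isOut-from : ∀ c → ΣConfig (length c) (𝟙 ∘ isOut c) ≡ #exits c
ΣConfig-isOut-from []              = +-identityʳ 0ℚ
ΣConfig-isOut-from (true ∷ [])     = refl
ΣConfig-isOut-from (false ∷ [])    = refl
ΣConfig-isOut-from (x ∷ c@(_ ∷ _)) = trans (ΣConfig-suc (length c) (𝟙 ∘ isOut (x ∷ c)))
  (trans (ΣConfig-cong (length c) (keep x)) (ΣConfig-isOut-from c))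
  where
  keep : ∀ x l → 𝟙 (isOut (x ∷ c) (true ∷ l)) + 𝟙 (isOut (x ∷ c) (false ∷ l)) ≡ 𝟙 (isOut c l)
  keep true  l = +-identityʳ (𝟙 (isOut c l))
  keep false l = +-identityˡ (𝟙 (isOut c l))

ΣConfig-isHop-from : ∀ c → ΣConfig (length c) (𝟙 ∘ isHop c) ≡ #hops c
ΣConfig-isHop-from []                 = +-identityʳ 0ℚ
ΣConfig-isHop-from (true ∷ [])        = refl
ΣConfig-isHop-from (false ∷ [])       = refl
ΣConfig-isHop-from (false ∷ c@(_ ∷ _)) = trans (ΣConfig-suc (length c) (𝟙 ∘ isHop (false ∷ c)))
  (trans (ΣConfig-cong (length c) (λ l → +-identityˡ (𝟙 (isHop c l)))) (ΣConfig-isHop-from c))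
ΣConfig-isHop-from (true ∷ true ∷ c)  = trans (ΣConfig-suc (suc (length c)) (𝟙 ∘ isHop (true ∷ true ∷ c)))
  (trans (ΣConfig-cong (suc (length c)) (λ l → +-identityʳ (𝟙 (isHop (true ∷ c) l))))
         (ΣConfig-isHop-from (true ∷ c)))
ΣConfig-isHop-from (true ∷ false ∷ c) = begin
  ΣConfig (suc (suc n)) (𝟙 ∘ isHop (true ∷ false ∷ c))
    ≡⟨ ΣConfig-suc (suc n) (𝟙 ∘ isHop (true ∷ false ∷ c)) ⟩
  ΣConfig (suc n) (λ l → 𝟙 (isHop (false ∷ c) l) + hopped l)
    ≡⟨ Σ-distrib-+ (configs (suc n)) (𝟙 ∘ isHop (false ∷ c)) hopped ⟩
  ΣConfig (suc n) (𝟙 ∘ isHop (false ∷ c)) + ΣConfig (suc n) hopped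
    ≡⟨ cong₂ _+_ (ΣConfig-isHop-from (false ∷ c)) Σhopped ⟩
  #hops (false ∷ c) + 1ℚ
    ≡⟨ +-comm (#hops (false ∷ c)) 1ℚ ⟩
  1ℚ + #hops (false ∷ c) ∎
  where
  n = length c
  hopped : List Bool → ℚ
  hopped l = 𝟙 (isHop (true ∷ false ∷ c) (false ∷ l))
  Σhopped : ΣConfig (suc n) hopped ≡ 1ℚ
  Σhopped = trans (ΣConfig-suc n hopped)
    (trans (ΣConfig-cong n (λ l → +-identityʳ (𝟙 (c == l)))) (ΣConfig-count c))

entryInflow : (List Bool → ℚ) → List Bool → ℚ
entryInflow h (true ∷ c) = h (false ∷ c)
entryInflow h _          = 0ℚ

exitInflow : (List Bool → ℚ) → List Bool → ℚ
exitInflow h []              = 0ℚ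
exitInflow h (x ∷ [])        = if x then 0ℚ else h (true ∷ [])
exitInflow h (x ∷ c@(_ ∷ _)) = exitInflow (h ∘ (x ∷_)) c

hopInflow : (List Bool → ℚ) → List Bool → ℚ
hopInflow h []                  = 0ℚ
hopInflow h (false ∷ true ∷ c)  = h (true ∷ false ∷ c) + hopInflow (h ∘ (false ∷_)) (true ∷ c)
hopInflow h (false ∷ false ∷ c) = hopInflow (h ∘ (false ∷_)) (false ∷ c)
hopInflow h (false ∷ [])        = 0ℚ
hopInflow h (true ∷ c)          = hopInflow (h ∘ (true ∷_)) c

ΣConfig-isIn-into : ∀ (h : List Bool → ℚ) c →
  ΣConfig (length c) (λ l → h l * 𝟙 (isIn l c)) ≡ entryInflow h c
ΣConfig-isIn-into h []          = drop-*0ˡ (h []) 0ℚ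
ΣConfig-isIn-into h (true ∷ c)  = trans (ΣConfig-suc (length c) (λ l → h l * 𝟙 (isIn l (true ∷ c))))
  (trans (ΣConfig-cong (length c) (λ l → drop-*0ˡ (h (true ∷ l)) _)) (ΣConfig-select c (h ∘ (false ∷_))))
ΣConfig-isIn-into h (false ∷ c) = trans (ΣConfig-suc (length c) (λ l → h l * 𝟙 (isIn l (false ∷ c))))
  (ΣConfig-zero (length c) (λ l → trans (drop-*0ˡ (h (true ∷ l)) _) (*-zeroʳ (h (false ∷ l)))))

ΣConfig-isOut-into : ∀ (h : List Bool → ℚ) c →
  ΣConfig (length c) (λ l → h l * 𝟙 (isOut l c)) ≡ exitInflow h c
ΣConfig-isOut-into h []              = drop-*0ˡ (h []) 0ℚ
ΣConfig-isOut-into h (true ∷ [])     = trans (drop-*0ˡ (h (true ∷ [])) _) (drop-*0ˡ (h (false ∷ [])) 0ℚ)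
ΣConfig-isOut-into h (false ∷ [])    =
  trans (cong (h (true ∷ []) * 1ℚ +_) (drop-*0ˡ (h (false ∷ [])) 0ℚ)) (trans (+-identityʳ _) (*-identityʳ _))
ΣConfig-isOut-into h (x ∷ c@(_ ∷ c′)) =
  trans (ΣConfig-peel (length c′) (λ l → h l * 𝟙 (isOut l (x ∷ c))) (λ l → h (x ∷ l) * 𝟙 (isOut l c)) (keep x))
        (ΣConfig-isOut-into (h ∘ (x ∷_)) c)
  where
  keep : ∀ x z l → h (true ∷ z ∷ l) * 𝟙 (isOut (true ∷ z ∷ l) (x ∷ c))
                   + h (false ∷ z ∷ l) * 𝟙 (isOut (false ∷ z ∷ l) (x ∷ c))
                   ≡ h (x ∷ z ∷ l) * 𝟙 (isOut (z ∷ l) c)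
  keep true  z l = drop-*0ʳ (h (false ∷ z ∷ l)) _
  keep false z l = drop-*0ˡ (h (true ∷ z ∷ l)) _

ΣConfig-isHop-into : ∀ (h : List Bool → ℚ) c →
  ΣConfig (length c) (λ l → h l * 𝟙 (isHop l c)) ≡ hopInflow h c
ΣConfig-isHop-into h []                  = drop-*0ˡ (h []) 0ℚ
ΣConfig-isHop-into h (true ∷ [])         = trans (drop-*0ˡ (h (true ∷ [])) _) (drop-*0ˡ (h (false ∷ [])) 0ℚ)
ΣConfig-isHop-into h (false ∷ [])        = trans (drop-*0ˡ (h (true ∷ [])) _) (drop-*0ˡ (h (false ∷ [])) 0ℚ)
ΣConfig-isHop-into h (false ∷ true ∷ c)  = begin
  ΣConfig (suc (suc n)) (λ l → h l * 𝟙 (isHop l (false ∷ true ∷ c)))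
    ≡⟨ ΣConfig-suc (suc n) (λ l → h l * 𝟙 (isHop l (false ∷ true ∷ c))) ⟩
  ΣConfig (suc n) (λ l → hopped l + h (false ∷ l) * 𝟙 (isHop l (true ∷ c)))
    ≡⟨ Σ-distrib-+ (configs (suc n)) hopped (λ l → h (false ∷ l) * 𝟙 (isHop l (true ∷ c))) ⟩
  ΣConfig (suc n) hopped + ΣConfig (suc n) (λ l → h (false ∷ l) * 𝟙 (isHop l (true ∷ c)))
    ≡⟨ cong₂ _+_ Σhopped (ΣConfig-isHop-into (h ∘ (false ∷_)) (true ∷ c)) ⟩
  h (true ∷ false ∷ c) + hopInflow (h ∘ (false ∷_)) (true ∷ c) ∎
  where
  n = length c
  hopped : List Bool → ℚ
  hopped l = h (true ∷ l) * 𝟙 (isHop (true ∷ l) (false ∷ true ∷ c))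
  Σhopped : ΣConfig (suc n) hopped ≡ h (true ∷ false ∷ c)
  Σhopped = trans (ΣConfig-suc n hopped)
    (trans (ΣConfig-cong n (λ l → drop-*0ˡ (h (true ∷ true ∷ l)) (h (true ∷ false ∷ l) * 𝟙 (l == c))))
           (ΣConfig-select c (λ l → h (true ∷ false ∷ l))))
ΣConfig-isHop-into h (false ∷ false ∷ c) =
  trans (ΣConfig-peel (length c) (λ l → h l * 𝟙 (isHop l (false ∷ false ∷ c)))
                                 (λ l → h (false ∷ l) * 𝟙 (isHop l (false ∷ c))) keep)
        (ΣConfig-isHop-into (h ∘ (false ∷_)) (false ∷ c))
  where
  keep : ∀ z l → h (true ∷ z ∷ l) * 𝟙 (isHop (true ∷ z ∷ l) (false ∷ false ∷ c))
                 + h (false ∷ z ∷ l) * 𝟙 (isHop (false ∷ z ∷ l) (false ∷ false ∷ c))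
                 ≡ h (false ∷ z ∷ l) * 𝟙 (isHop (z ∷ l) (false ∷ c))
  keep true  l = drop-*0ˡ (h (true ∷ true ∷ l)) _
  keep false l = drop-*0ˡ (h (true ∷ false ∷ l)) _
ΣConfig-isHop-into h (true ∷ c@(_ ∷ c′)) =
  trans (ΣConfig-peel (length c′) (λ l → h l * 𝟙 (isHop l (true ∷ c))) (λ l → h (true ∷ l) * 𝟙 (isHop l c)) keep)
        (ΣConfig-isHop-into (h ∘ (true ∷_)) c)
  where
  keep : ∀ z l → h (true ∷ z ∷ l) * 𝟙 (isHop (true ∷ z ∷ l) (true ∷ c))
                 + h (false ∷ z ∷ l) * 𝟙 (isHop (false ∷ z ∷ l) (true ∷ c))
                 ≡ h (true ∷ z ∷ l) * 𝟙 (isHop (z ∷ l) c)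
  keep true  l = drop-*0ʳ (h (false ∷ true ∷ l)) _
  keep false l = drop-*0ʳ (h (false ∷ false ∷ l)) _

outRate : ℚ → ℚ → List Bool → ℚ
outRate α β c = α * #entries c + β * #exits c + #hops c

inflow : ℚ → ℚ → (List Bool → ℚ) → List Bool → ℚ
inflow α β h c = α * entryInflow h c + β * exitInflow h c + hopInflow h c

ΣConfig-rate-from : ∀ α β c → ΣConfig (length c) (rate α β c) ≡ outRate α β c
ΣConfig-rate-from α β c = begin
  ΣConfig (length c) (rate α β c)
    ≡⟨ ΣConfig-cong (length c) (rate-decomposition α β c) ⟩
  ΣConfig (length c) (λ l → α * 𝟙 (isIn c l) + β * 𝟙 (isOut c l) + 𝟙 (isHop c l))
    ≡⟨ ΣConfig-linear (length c) α β (𝟙 ∘ isIn c) (𝟙 ∘ isOut c) (𝟙 ∘ isHop c) ⟩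
  α * ΣConfig (length c) (𝟙 ∘ isIn c) + β * ΣConfig (length c) (𝟙 ∘ isOut c) + Hop
    ≡⟨ cong₂ (λ a b → α * a + β * b + Hop) (ΣConfig-isIn-from c) (ΣConfig-isOut-from c) ⟩
  α * #entries c + β * #exits c + Hop
    ≡⟨ cong (α * #entries c + β * #exits c +_) (ΣConfig-isHop-from c) ⟩
  outRate α β c ∎
  where
  Hop = ΣConfig (length c) (𝟙 ∘ isHop c)

ΣConfig-rate-into : ∀ α β (h : List Bool → ℚ) c →
  ΣConfig (length c) (λ l → h l * rate α β l c) ≡ inflow α β h c
ΣConfig-rate-into α β h c = begin
  ΣConfig (length c) (λ l → h l * rate α β l c)
    ≡⟨ ΣConfig-cong (length c) distribute ⟩
  ΣConfig (length c) (λ l → α * In l + β * Out l + Hop l)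
    ≡⟨ ΣConfig-linear (length c) α β In Out Hop ⟩
  α * ΣConfig (length c) In + β * ΣConfig (length c) Out + ΣConfig (length c) Hop
    ≡⟨ cong₂ (λ a b → α * a + β * b + ΣConfig (length c) Hop) (ΣConfig-isIn-into h c)
                                                                 (ΣConfig-isOut-into h c) ⟩
  α * entryInflow h c + β * exitInflow h c + ΣConfig (length c) Hop
    ≡⟨ cong (α * entryInflow h c + β * exitInflow h c +_) (ΣConfig-isHop-into h c) ⟩
  inflow α β h c ∎
  where
  In Out Hop : List Bool → ℚ
  In  l = h l * 𝟙 (isIn l c)
  Out l = h l * 𝟙 (isOut l c)
  Hop l = h l * 𝟙 (isHop l c)
  distribute : ∀ l → h l * rate α β l c ≡ α * In l + β * Out l + Hop l
  distribute l = trans (cong (h l *_) (rate-decomposition α β l c))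
    (solve 6 (λ h α β i o p → h :* (α :* i :+ β :* o :+ p) := α :* (h :* i) :+ β :* (h :* o) :+ h :* p)
           refl (h l) α β (𝟙 (isIn l c)) (𝟙 (isOut l c)) (𝟙 (isHop l c)))

-- The matrix-product relations imply stationarity

BulkRelation : (List Bool → ℚ) → Set
BulkRelation g = ∀ u v → g (u ++ true ∷ false ∷ v) ≡ g (u ++ true ∷ v) + g (u ++ false ∷ v)

LeftRelation : ℚ → (List Bool → ℚ) → Set
LeftRelation a g = ∀ v → g (false ∷ v) ≡ a * g v

RightRelation : ℚ → (List Bool → ℚ) → Set
RightRelation b g = ∀ u → g (u ++ true ∷ []) ≡ b * g u

-- For f(w) = ⟨W| X_{w₁} ⋯ X_{wₙ} |V⟩ with X_● = D and X_○ = E these are the relations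
-- DE = D + E, ⟨W|E = a⟨W| and D|V⟩ = b|V⟩.
record MatrixAnsatz (a b : ℚ) (g : List Bool → ℚ) : Set where
  field
    bulk  : BulkRelation g
    left  : LeftRelation a g
    right : RightRelation b g

sign : Bool → ℚ
sign true  = - 1ℚ
sign false = 1ℚ

firstHat : (List Bool → ℚ) → List Bool → ℚ
firstHat g []      = 0ℚ
firstHat g (x ∷ c) = sign x * g c

lastHat : (List Bool → ℚ) → List Bool → ℚ
lastHat g []              = 0ℚ
lastHat g (x ∷ [])        = sign x * g []
lastHat g (x ∷ c@(_ ∷ _)) = lastHat (g ∘ (x ∷_)) c

+-telescope : ∀ {A B H A′ B′ H′ F L : ℚ} →
  A + F ≡ A′ → B ≡ B′ + L → H + L ≡ H′ + F → A + B + H ≡ A′ + B′ + H′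
+-telescope {A} {B} {H} {A′} {B′} {H′} {F} {L} refl refl e = begin
  A + (B′ + L) + H
    ≡⟨ solve 5 (λ A B′ L H F → A :+ (B′ :+ L) :+ H := (A :+ F) :+ B′ :+ (H :+ L) :- F) refl A B′ L H F ⟩
  (A + F) + B′ + (H + L) - F
    ≡⟨ cong (λ z → (A + F) + B′ + z - F) e ⟩
  (A + F) + B′ + (H′ + F) - F
    ≡⟨ solve 4 (λ A F B′ H′ → (A :+ F) :+ B′ :+ (H′ :+ F) :- F := (A :+ F) :+ B′ :+ H′) refl A F B′ H′ ⟩
  (A + F) + B′ + H′ ∎

inverse-cancel : ∀ {α a} → α * a ≡ 1ℚ → ∀ x → α * (a * x) ≡ x
inverse-cancel {α} {a} αa≡1 x = begin
  α * (a * x)  ≡⟨ *-assoc α a x ⟨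
  (α * a) * x  ≡⟨ cong (_* x) αa≡1 ⟩
  1ℚ * x       ≡⟨ *-identityˡ x ⟩
  x            ∎

module _ {α a : ℚ} (αa≡1 : α * a ≡ 1ℚ) {g : List Bool → ℚ} (left : LeftRelation a g) where

  private
    removeLeft : ∀ c → α * g (false ∷ c) ≡ g c
    removeLeft c = trans (cong (α *_) (left c)) (inverse-cancel {α} {a} αa≡1 (g c))

  entry-balance : ∀ c → α * entryInflow g c + firstHat g c ≡ α * #entries c * g c
  entry-balance []          = solve 2 (λ α y → α :* con 0ℚ :+ con 0ℚ := α :* con 0ℚ :* y) refl α (g [])
  entry-balance (true ∷ c)  = begin
    α * g (false ∷ c) + - 1ℚ * g c  ≡⟨ cong (_+ - 1ℚ * g c) (removeLeft c) ⟩
    g c + - 1ℚ * g c                ≡⟨ solve 3 (λ α y z → y :+ con (- 1ℚ) :* y := α :* con 0ℚ :* z) refl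
                                                α (g c) (g (true ∷ c)) ⟩
    α * 0ℚ * g (true ∷ c)           ∎
  entry-balance (false ∷ c) = begin
    α * 0ℚ + 1ℚ * g c        ≡⟨ solve 2 (λ α y → α :* con 0ℚ :+ con 1ℚ :* y := y) refl α (g c) ⟩
    g c                      ≡⟨ removeLeft c ⟨
    α * g (false ∷ c)        ≡⟨ cong (_* g (false ∷ c)) (*-identityʳ α) ⟨
    α * 1ℚ * g (false ∷ c)   ∎

module _ {β b : ℚ} (βb≡1 : β * b ≡ 1ℚ) where

  private
    removeRight : ∀ {g} → RightRelation b g → β * g (true ∷ []) ≡ g []
    removeRight {g} right = trans (cong (β *_) (right [])) (inverse-cancel {β} {b} βb≡1 (g []))

  exit-balance : ∀ {g} → RightRelation b g → ∀ c → β * exitInflow g c ≡ β * #exits c * g c + lastHat g c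
  exit-balance {g} right []           =
    solve 2 (λ β y → β :* con 0ℚ := β :* con 0ℚ :* y :+ con 0ℚ) refl β (g [])
  exit-balance {g} right (true ∷ [])  = begin
    β * 0ℚ                               ≡⟨ solve 2 (λ β y → β :* con 0ℚ := y :+ con (- 1ℚ) :* y) refl β (g []) ⟩
    g [] + - 1ℚ * g []                   ≡⟨ cong (_+ - 1ℚ * g []) (removeRight right) ⟨
    β * g (true ∷ []) + - 1ℚ * g []      ≡⟨ cong (λ z → z * g (true ∷ []) + - 1ℚ * g []) (*-identityʳ β) ⟨
    β * 1ℚ * g (true ∷ []) + - 1ℚ * g [] ∎
  exit-balance {g} right (false ∷ []) = begin
    β * g (true ∷ [])                    ≡⟨ removeRight right ⟩
    g []                                 ≡⟨ solve 3 (λ β y z → y := β :* con 0ℚ :* z :+ con 1ℚ :* y) refl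
                                                    β (g []) (g (false ∷ [])) ⟩
    β * 0ℚ * g (false ∷ []) + 1ℚ * g []  ∎
  exit-balance {g} right (x ∷ c@(_ ∷ _)) = exit-balance {g ∘ (x ∷_)} (right ∘ (x ∷_)) c

hop-balance : ∀ {g} → BulkRelation g → ∀ c → hopInflow g c + lastHat g c ≡ #hops c * g c + firstHat g c
hop-balance {g} bulk []           = solve 1 (λ y → con 0ℚ :+ con 0ℚ := con 0ℚ :* y :+ con 0ℚ) refl (g [])
hop-balance {g} bulk (true ∷ [])  =
  solve 2 (λ y z → con 0ℚ :+ con (- 1ℚ) :* y := con 0ℚ :* z :+ con (- 1ℚ) :* y) refl (g []) (g (true ∷ []))
hop-balance {g} bulk (false ∷ []) =
  solve 2 (λ y z → con 0ℚ :+ con 1ℚ :* y := con 0ℚ :* z :+ con 1ℚ :* y) refl (g []) (g (false ∷ []))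
hop-balance {g} bulk (false ∷ false ∷ c) = hop-balance (bulk ∘ (false ∷_)) (false ∷ c)
hop-balance {g} bulk (true ∷ true ∷ c)   = hop-balance (bulk ∘ (true ∷_)) (true ∷ c)
hop-balance {g} bulk (false ∷ true ∷ c)  = begin
  g (true ∷ false ∷ c) + H + L
    ≡⟨ solve 3 (λ p q r → p :+ q :+ r := p :+ (q :+ r)) refl (g (true ∷ false ∷ c)) H L ⟩
  g (true ∷ false ∷ c) + (H + L)
    ≡⟨ cong₂ _+_ (bulk [] c) (hop-balance (bulk ∘ (false ∷_)) (true ∷ c)) ⟩
  (g (true ∷ c) + g (false ∷ c)) + (#hops (true ∷ c) * g (false ∷ true ∷ c) + - 1ℚ * g (false ∷ c))
    ≡⟨ solve 4 (λ p q h s → (p :+ q) :+ (h :* s :+ con (- 1ℚ) :* q) := h :* s :+ con 1ℚ :* p) refl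
         (g (true ∷ c)) (g (false ∷ c)) (#hops (true ∷ c)) (g (false ∷ true ∷ c)) ⟩
  #hops (true ∷ c) * g (false ∷ true ∷ c) + 1ℚ * g (true ∷ c) ∎
  where
  H = hopInflow (g ∘ (false ∷_)) (true ∷ c)
  L = lastHat (g ∘ (false ∷_)) (true ∷ c)
hop-balance {g} bulk (true ∷ false ∷ c)  = begin
  hopInflow (g ∘ (true ∷_)) (false ∷ c) + lastHat (g ∘ (true ∷_)) (false ∷ c)
    ≡⟨ hop-balance (bulk ∘ (true ∷_)) (false ∷ c) ⟩
  h * g (true ∷ false ∷ c) + 1ℚ * g (true ∷ c)
    ≡⟨ cong (λ z → h * z + 1ℚ * g (true ∷ c)) (bulk [] c) ⟩
  h * (g (true ∷ c) + g (false ∷ c)) + 1ℚ * g (true ∷ c)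
    ≡⟨ solve 3 (λ h p q → h :* (p :+ q) :+ con 1ℚ :* p := (con 1ℚ :+ h) :* (p :+ q) :+ con (- 1ℚ) :* q)
               refl h (g (true ∷ c)) (g (false ∷ c)) ⟩
  (1ℚ + h) * (g (true ∷ c) + g (false ∷ c)) + - 1ℚ * g (false ∷ c)
    ≡⟨ cong (λ z → (1ℚ + h) * z + - 1ℚ * g (false ∷ c)) (bulk [] c) ⟨
  (1ℚ + h) * g (true ∷ false ∷ c) + - 1ℚ * g (false ∷ c) ∎
  where
  h = #hops (false ∷ c)

balance : ∀ {α β a b g} → α * a ≡ 1ℚ → β * b ≡ 1ℚ → MatrixAnsatz a b g →
  ∀ c → g c * outRate α β c ≡ inflow α β g c
balance {α} {β} {a} {b} {g} αa≡1 βb≡1 M c = begin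
  g c * outRate α β c
    ≡⟨ solve 6 (λ y α e β x h → y :* (α :* e :+ β :* x :+ h) := α :* e :* y :+ β :* x :* y :+ h :* y) refl
         (g c) α (#entries c) β (#exits c) (#hops c) ⟩
  α * #entries c * g c + β * #exits c * g c + #hops c * g c
    ≡⟨ +-telescope {A = α * entryInflow g c} {H = hopInflow g c}
         (entry-balance {α} {a} αa≡1 left c) (exit-balance {β} {b} βb≡1 right c) (hop-balance bulk c) ⟨
  inflow α β g c ∎
  where open MatrixAnsatz M

MatrixAnsatz-scale : ∀ {a b g} k → MatrixAnsatz a b g → MatrixAnsatz a b (λ w → k * g w)
MatrixAnsatz-scale {a} {b} {g} k M = record
  { bulk  = λ u v → trans (cong (k *_) (bulk u v)) (*-distribˡ-+ k (g (u ++ true ∷ v)) (g (u ++ false ∷ v)))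
  ; left  = λ v → trans (cong (k *_) (left v)) (swap-* k a (g v))
  ; right = λ u → trans (cong (k *_) (right u)) (swap-* k b (g u))
  }
  where
  open MatrixAnsatz M
  swap-* : ∀ k a x → k * (a * x) ≡ a * (k * x)
  swap-* = solve 3 (λ k a x → k :* (a :* x) := a :* (k :* x)) refl

-- Plane binary trees

split-++-∷ : ∀ {A : Set} (xs ys P : List A) {x : A} {B : List A} → xs ++ ys ≡ P ++ x ∷ B →
  (∃[ B′ ] xs ≡ P ++ x ∷ B′ × B ≡ B′ ++ ys) ⊎ (∃[ P′ ] P ≡ xs ++ P′ × ys ≡ P′ ++ x ∷ B)
split-++-∷ []       ys P       e = inj₂ (P , refl , e)
split-++-∷ (_ ∷ xs) ys []      e with refl , e′ ← ∷-injective e = inj₁ (xs , refl , sym e′)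
split-++-∷ (_ ∷ xs) ys (_ ∷ P) e with refl , e′ ← ∷-injective e with split-++-∷ xs ys P e′
... | inj₁ (B′ , refl , e″) = inj₁ (B′ , refl , e″)
... | inj₂ (P′ , refl , e″) = inj₂ (P′ , refl , e″)

split-++-∷∷ : ∀ {A : Set} (xs ys P : List A) {x y : A} {B : List A} → xs ++ ys ≡ P ++ x ∷ y ∷ B →
  (∃[ B′ ] xs ≡ P ++ x ∷ y ∷ B′ × B ≡ B′ ++ ys)
  ⊎ (∃[ P′ ] P ≡ xs ++ P′ × ys ≡ P′ ++ x ∷ y ∷ B)
  ⊎ (xs ≡ P ++ x ∷ [] × ys ≡ y ∷ B)
split-++-∷∷ xs ys P e with split-++-∷ xs ys P e
... | inj₂ inYs                = inj₂ (inj₁ inYs)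
... | inj₁ ([] , xs≡ , ys≡)     = inj₂ (inj₂ (xs≡ , sym ys≡))
... | inj₁ (_ ∷ B′ , xs≡ , e′) with refl , B≡ ← ∷-injective e′ = inj₁ (B′ , xs≡ , B≡)

[]≢++∷ : ∀ {A : Set} (P : List A) {x B} → [] ≢ P ++ x ∷ B
[]≢++∷ []      ()
[]≢++∷ (_ ∷ _) ()

null-++ʳ : ∀ {A : Set} (xs : List A) {ys} → null ys ≡ false → null (xs ++ ys) ≡ false
null-++ʳ []      e = e
null-++ʳ (_ ∷ _) _ = refl

null-++ˡ : ∀ {A : Set} (xs : List A) {ys} → null xs ≡ false → null (xs ++ ys) ≡ false
null-++ˡ (_ ∷ _) _ = refl

flags-length : ∀ d T → length (flags d T) ≡ leaves T
flags-length d leaf       = refl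
flags-length d (node l r) =
  trans (length-++ (flags true l)) (cong₂ ℕ._+_ (flags-length true l) (flags-length false r))

null-flags : ∀ d T → null (flags d T) ≡ false
null-flags d leaf       = refl
null-flags d (node l r) = null-++ˡ (flags true l) (null-flags true l)

flags-true-head : ∀ T → ∃[ ys ] flags true T ≡ true ∷ ys
flags-true-head leaf       = [] , refl
flags-true-head (node l r) with ys , e ← flags-true-head l = ys ++ flags false r , cong (_++ flags false r) e

flags-false-last : ∀ T → ∃[ ys ] flags false T ≡ ys ++ false ∷ []
flags-false-last leaf       = [] , refl
flags-false-last (node l r) with ys , e ← flags-false-last r =
  flags true l ++ ys , trans (cong (flags true l ++_) e) (sym (++-assoc (flags true l) ys (false ∷ [])))

bracket : List Bool → List Bool
bracket v = true ∷ v ++ false ∷ []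

word : Tree → List Bool
word T = bracket (R T)

inner : List Bool → List Bool
inner []       = []
inner (_ ∷ xs) = dropLast xs

R-node : ∀ l r → R (node l r) ≡ inner (flags true l ++ flags false r)
R-node l r with flags true l ++ flags false r
... | []    = refl
... | _ ∷ _ = refl

dropLast-∷ʳ : ∀ (xs : List Bool) y → dropLast (xs ++ y ∷ []) ≡ xs
dropLast-∷ʳ []           y = refl
dropLast-∷ʳ (x ∷ [])     y = refl
dropLast-∷ʳ (x ∷ x′ ∷ xs) y = cong (x ∷_) (dropLast-∷ʳ (x′ ∷ xs) y)

flags-node : ∀ d l r → flags d (node l r) ≡ word (node l r)
flags-node d l r with ys₁ , e₁ ← flags-true-head l | ys₂ , e₂ ← flags-false-last r = begin
  flags true l ++ flags false r        ≡⟨ flags≡ ⟩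
  true ∷ (ys₁ ++ ys₂) ++ false ∷ []    ≡⟨ cong (λ w → true ∷ w ++ false ∷ []) R≡ ⟨
  word (node l r)                      ∎
  where
  flags≡ : flags true l ++ flags false r ≡ true ∷ (ys₁ ++ ys₂) ++ false ∷ []
  flags≡ = trans (cong₂ _++_ e₁ e₂) (cong (true ∷_) (sym (++-assoc ys₁ ys₂ (false ∷ []))))
  R≡ : R (node l r) ≡ ys₁ ++ ys₂
  R≡ = trans (R-node l r) (trans (cong inner flags≡) (dropLast-∷ʳ (ys₁ ++ ys₂) false))

bracket-injective : ∀ {v w} → bracket v ≡ bracket w → v ≡ w
bracket-injective {v} {w} e = ∷ʳ-injectiveˡ v w (∷-injectiveʳ e)

bracket-++ : ∀ u x w → bracket (u ++ x ∷ w) ≡ (true ∷ u) ++ x ∷ w ++ false ∷ []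
bracket-++ u x w = cong (true ∷_) (++-assoc u (x ∷ w) (false ∷ []))

leaves-positive : ∀ T → 0 ℕ.< leaves T
leaves-positive leaf       = ℕ.z<s
leaves-positive (node l r) = ℕ.<-≤-trans (leaves-positive l) (ℕ.m≤m+n (leaves l) (leaves r))

1<leaves-node : ∀ l r → 1 ℕ.< leaves (node l r)
1<leaves-node l r = ℕ.≤-<-trans (leaves-positive l) (ℕ.m<m+n (leaves l) (leaves-positive r))

flags-word : ∀ d T → 1 ℕ.< leaves T → flags d T ≡ word T
flags-word d leaf       (ℕ.s≤s ())
flags-word d (node l r) _ = flags-node d l r

-- Replaces the i-th endpoint, counting from 0, by a cherry.
expand : ℕ → Tree → Tree
expand i leaf = node leaf leaf
expand i (node l r) with i ℕ.<? leaves l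
... | yes _ = node (expand i l) r
... | no  _ = node l (expand (i ∸ leaves l) r)

expand-left : ∀ {i} l r → i ℕ.< leaves l → expand i (node l r) ≡ node (expand i l) r
expand-left {i} l r i<l with i ℕ.<? leaves l
... | yes _   = refl
... | no  i≮l = contradiction i<l i≮l

expand-right : ∀ {i} l r → leaves l ℕ.≤ i → expand i (node l r) ≡ node l (expand (i ∸ leaves l) r)
expand-right {i} l r l≤i with i ℕ.<? leaves l
... | yes i<l = contradiction l≤i (ℕ.<⇒≱ i<l)
... | no  _   = refl

leaves-expand : ∀ i T → leaves (expand i T) ≡ suc (leaves T)
leaves-expand i leaf = refl
leaves-expand i (node l r) with i ℕ.<? leaves l
... | yes _ = cong (ℕ._+ leaves r) (leaves-expand i l)
... | no  _ = trans (cong (leaves l ℕ.+_) (leaves-expand (i ∸ leaves l) r)) (ℕ.+-suc (leaves l) (leaves r))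

<-leaves-expand : ∀ {j} i T → j ℕ.< leaves T → j ℕ.< leaves (expand i T)
<-leaves-expand i T j<T = subst (_ ℕ.<_) (sym (leaves-expand i T)) (ℕ.m<n⇒m<1+n j<T)

node-injective : ∀ {l r l′ r′} → node l r ≡ node l′ r′ → l ≡ l′ × r ≡ r′
node-injective refl = refl , refl

expand≢leaf : ∀ i T → expand i T ≢ leaf
expand≢leaf i leaf ()
expand≢leaf i (node l r) with i ℕ.<? leaves l
... | yes _ = λ ()
... | no  _ = λ ()

expand-injective : ∀ i {S T} → expand i S ≡ expand i T → S ≡ T
expand-injective i {leaf}     {leaf}     _ = refl
expand-injective i {leaf}     {node l r} with i ℕ.<? leaves l
... | yes _ = λ e → contradiction (sym (proj₁ (node-injective e))) (expand≢leaf i l)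
... | no  _ = λ e → contradiction (sym (proj₂ (node-injective e))) (expand≢leaf (i ∸ leaves l) r)
expand-injective i {node l r} {leaf}     with i ℕ.<? leaves l
... | yes _ = λ e → contradiction (proj₁ (node-injective e)) (expand≢leaf i l)
... | no  _ = λ e → contradiction (proj₂ (node-injective e)) (expand≢leaf (i ∸ leaves l) r)
expand-injective i {node l r} {node l′ r′} with i ℕ.<? leaves l | i ℕ.<? leaves l′
... | yes _   | yes _    = λ e → case node-injective e of λ where
  (el , refl) → cong (λ l → node l r) (expand-injective i el)
... | no  _   | no  _    = λ e → case node-injective e of λ where
  (refl , er) → cong (node l) (expand-injective (i ∸ leaves l) er)
... | yes i<l | no  i≮l′ = λ e →
  contradiction (subst (λ T → i ℕ.< leaves T) (proj₁ (node-injective e)) (<-leaves-expand i l i<l)) i≮l′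
... | no  i≮l | yes i<l′ = λ e →
  contradiction (subst (λ T → i ℕ.< leaves T) (sym (proj₁ (node-injective e))) (<-leaves-expand i l′ i<l′))
                i≮l

sucIfNull : List Bool → ℕ → ℕ
sucIfNull P k = if null P then suc k else k

sucIfNull-suc : ∀ P {k} → suc (sucIfNull P k) ≡ sucIfNull P (suc k)
sucIfNull-suc []      = refl
sucIfNull-suc (_ ∷ _) = refl

sucIfNull-nonNull : ∀ {P} k → null P ≡ false → k ≡ sucIfNull P k
sucIfNull-nonNull k e rewrite e = refl

length-<-leaves : ∀ d T {P x B} → flags d T ≡ P ++ x ∷ B → length P ℕ.< leaves T
length-<-leaves d T {P} e = subst (length P ℕ.<_) (trans (cong length (sym e)) (flags-length d T))
  (subst (length P ℕ.<_) (sym (length-++ P)) (ℕ.m<m+n (length P) ℕ.z<s))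

expand-after : ∀ l r P′ → expand (length (flags true l ++ P′)) (node l r) ≡ node l (expand (length P′) r)
expand-after l r P′ rewrite length-++ (flags true l) {P′} | flags-length true l =
  trans (expand-right l r (ℕ.m≤m+n (leaves l) (length P′)))
        (cong (λ i → node l (expand i r)) (ℕ.m+n∸m≡n (leaves l) (length P′)))

-- Only expanding the leftmost (rightmost) endpoint lengthens the leftmost (rightmost) path.
record Expansion (d : Bool) (T : Tree) (P B : List Bool) : Set where
  field
    flags-expand  : flags d (expand (length P) T) ≡ P ++ true ∷ false ∷ B
    depthL-expand : depthL (expand (length P) T) ≡ sucIfNull P (depthL T)
    depthR-expand : depthR (expand (length P) T) ≡ sucIfNull B (depthR T)

expansion : ∀ d T P {x} B → flags d T ≡ P ++ x ∷ B → Expansion d T P B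
expansion d leaf []      B e with refl ← ∷-injectiveʳ e = record
  { flags-expand = refl ; depthL-expand = refl ; depthR-expand = refl }
expansion d leaf (_ ∷ P) B e = contradiction (∷-injectiveʳ e) ([]≢++∷ P)
expansion d (node l r) P B e with split-++-∷ (flags true l) (flags false r) P e
... | inj₁ (B′ , inL , refl) = record
  { flags-expand  = trans (cong (flags d) left≡)
      (trans (cong (_++ flags false r) flags-expand) (++-assoc P (true ∷ false ∷ B′) (flags false r)))
  ; depthL-expand = trans (cong depthL left≡) (trans (cong suc depthL-expand) (sucIfNull-suc P))
  ; depthR-expand = trans (cong depthR left≡)
      (sucIfNull-nonNull (suc (depthR r)) (null-++ʳ B′ (null-flags false r)))
  }
  where
  open Expansion (expansion true l P B′ inL)
  left≡ = expand-left l r (length-<-leaves true l inL)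
... | inj₂ (P′ , refl , inR) = record
  { flags-expand  = trans (cong (flags d) right≡)
      (trans (cong (flags true l ++_) flags-expand) (sym (++-assoc (flags true l) P′ (true ∷ false ∷ B))))
  ; depthL-expand = trans (cong depthL right≡)
      (sucIfNull-nonNull (suc (depthL l)) (null-++ˡ (flags true l) (null-flags true l)))
  ; depthR-expand = trans (cong depthR right≡) (trans (cong suc depthR-expand) (sucIfNull-suc B))
  }
  where
  open Expansion (expansion false r P′ B inR)
  right≡ = expand-after l r P′

cherry : ∀ d l r P B → flags true l ≡ P ++ true ∷ [] → flags false r ≡ false ∷ B →
  ∃[ T′ ] ∃[ x ] node l r ≡ expand (length P) T′ × flags d T′ ≡ P ++ x ∷ B
cherry d leaf leaf P B lastL headR with refl ← ∷ʳ-injectiveˡ [] P lastL | refl ← ∷-injectiveʳ headR =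
  leaf , d , refl , refl
cherry d (node l₁ l₂) r P B lastL _ =
  contradiction (∷ʳ-injectiveʳ (true ∷ R (node l₁ l₂)) P (trans (sym (flags-node true l₁ l₂)) lastL)) λ ()
cherry d leaf (node r₁ r₂) P B _ headR =
  contradiction (∷-injectiveˡ (trans (sym (flags-node false r₁ r₂)) headR)) λ ()

expand-surjective : ∀ d T P B → flags d T ≡ P ++ true ∷ false ∷ B →
  ∃[ T′ ] ∃[ x ] T ≡ expand (length P) T′ × flags d T′ ≡ P ++ x ∷ B
expand-surjective d leaf []      B e with () ← ∷-injectiveʳ e
expand-surjective d leaf (_ ∷ P) B e = contradiction (∷-injectiveʳ e) ([]≢++∷ P)
expand-surjective d (node l r) P B e with split-++-∷∷ (flags true l) (flags false r) P e
... | inj₁ (B′ , inL , refl) with l′ , x , refl , e′ ← expand-surjective true l P B′ inL =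
  node l′ r , x , sym (expand-left l′ r (length-<-leaves true l′ e′)) ,
  trans (cong (_++ flags false r) e′) (++-assoc P (x ∷ B′) (flags false r))
... | inj₂ (inj₁ (P′ , refl , inR)) with r′ , x , refl , e′ ← expand-surjective false r P′ B inR =
  node l r′ , x , sym (expand-after l r′ P′) ,
  trans (cong (flags true l ++_) e′) (sym (++-assoc (flags true l) P′ (x ∷ B)))
... | inj₂ (inj₂ (lastL , headR)) = cherry d l r P B lastL headR

concatMap-map-node : (xs ys : List Tree) →
  concatMap (λ l → map (node l) ys) xs ≡ cartesianProductWith node xs ys
concatMap-map-node []       ys = refl
concatMap-map-node (x ∷ xs) ys = cong (map (node x) ys ++_) (concatMap-map-node xs ys)

∈-treesDepth : ∀ d T → leaves T ℕ.≤ suc d → T ∈ treesDepth d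
∈-treesDepth zero    leaf       _ = here refl
∈-treesDepth (suc d) leaf       _ = here refl
∈-treesDepth zero    (node l r) p = contradiction p (ℕ.<⇒≱ (1<leaves-node l r))
∈-treesDepth (suc d) (node l r) p = there (subst (node l r ∈_)
  (sym (concatMap-map-node (treesDepth d) (treesDepth d)))
  (∈-cartesianProductWith⁺ node (∈-treesDepth d l l≤) (∈-treesDepth d r r≤)))
  where
  l≤ = ℕ.≤-pred (ℕ.≤-trans (ℕ.m<m+n (leaves l) (leaves-positive r)) p)
  r≤ = ℕ.≤-pred (ℕ.≤-trans (ℕ.m<n+m (leaves r) (leaves-positive l)) p)

treesDepth-unique : ∀ d → Unique (treesDepth d)
treesDepth-unique zero    = All.[] ∷ []
treesDepth-unique (suc d) rewrite concatMap-map-node (treesDepth d) (treesDepth d) =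
  All.tabulate leaf∉
  ∷ Unique.cartesianProductWith⁺ node node-injective (treesDepth-unique d) (treesDepth-unique d)
  where
  leaf∉ : ∀ {T} → T ∈ cartesianProductWith node (treesDepth d) (treesDepth d) → leaf ≢ T
  leaf∉ T∈ with _ , _ , _ , _ , refl ← ∈-cartesianProductWith⁻ node (treesDepth d) (treesDepth d) T∈ = λ ()

∈-𝒯⁺ : ∀ {n T} → leaves T ≡ suc (suc n) → T ∈ 𝒯 n
∈-𝒯⁺ {n} {T} e = ∈-filter⁺ (λ T → leaves T ℕ.≟ suc (suc n))
  (∈-treesDepth (suc (suc n)) T (subst (ℕ._≤ suc (suc (suc n))) (sym e) (ℕ.n≤1+n _))) e

∈-𝒯⁻ : ∀ {n T} → T ∈ 𝒯 n → leaves T ≡ suc (suc n)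
∈-𝒯⁻ {n} T∈ = proj₂ (∈-filter⁻ (λ T → leaves T ℕ.≟ suc (suc n)) {xs = treesDepth (suc (suc n))} T∈)

𝒯-unique : ∀ n → Unique (𝒯 n)
𝒯-unique n = Unique.filter⁺ (λ T → leaves T ℕ.≟ suc (suc n)) (treesDepth-unique (suc (suc n)))

-- The tree weights satisfy the matrix-product relations

word≟ : (w : List Bool) → Decidable (λ T → word T ≡ w)
word≟ w T = ≡-dec Bool._≟_ (word T) w

treesWith : ℕ → List Bool → List Tree
treesWith n w = filter (word≟ w) (𝒯 n)

∈-treesWith⁻ : ∀ {n w T} → T ∈ treesWith n w → T ∈ 𝒯 n × word T ≡ w
∈-treesWith⁻ {n} {w} = ∈-filter⁻ (word≟ w) {xs = 𝒯 n}

1<leaves-𝒯 : ∀ {n T} → T ∈ 𝒯 n → 1 ℕ.< leaves T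
1<leaves-𝒯 {n} T∈ rewrite ∈-𝒯⁻ {n} T∈ = ℕ.s≤s (ℕ.s≤s ℕ.z≤n)

1<leaves-expand : ∀ i T → 1 ℕ.< leaves (expand i T)
1<leaves-expand i T rewrite leaves-expand i T = ℕ.s≤s (leaves-positive T)

Σ-treesWith-expand : ∀ n P B (g : Tree → ℚ) →
  Σ[ treesWith (suc n) (P ++ true ∷ false ∷ B) ] g
    ≡ Σ[ treesWith n (P ++ true ∷ B) ] (g ∘ expand (length P))
      + Σ[ treesWith n (P ++ false ∷ B) ] (g ∘ expand (length P))
Σ-treesWith-expand n P B g = begin
  Σ[ treesWith (suc n) w●○ ] g
    ≡⟨ Σ-reindex (expand i) g (Unique.filter⁺ w●∪w○? (𝒯-unique n))
                 (Unique.filter⁺ (word≟ w●○) (𝒯-unique (suc n)))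
                 (expand-injective i) into onto ⟩
  Σ[ filter w●∪w○? (𝒯 n) ] (g ∘ expand i)
    ≡⟨ Σ-filter-⊎ (word≟ w●) (word≟ w○) (λ {T} → disjoint {T}) (𝒯 n) (g ∘ expand i) ⟩
  Σ[ treesWith n w● ] (g ∘ expand i) + Σ[ treesWith n w○ ] (g ∘ expand i) ∎
  where
  i = length P
  w●○ w● w○ : List Bool
  w●○ = P ++ true ∷ false ∷ B
  w●  = P ++ true ∷ B
  w○  = P ++ false ∷ B
  w●∪w○? : Decidable (λ T → word T ≡ w● ⊎ word T ≡ w○)
  w●∪w○? = word≟ w● ∪? word≟ w○
  disjoint : ∀ {T} → word T ≡ w● → word T ≡ w○ → ⊥
  disjoint e● e○ = contradiction (++-cancelˡ P _ _ (trans (sym e●) e○)) λ ()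
  word-expand : ∀ {T x} → T ∈ 𝒯 n → word T ≡ P ++ x ∷ B → word (expand i T) ≡ w●○
  word-expand {T} T∈ w≡ = trans (sym (flags-word true (expand i T) (1<leaves-expand i T)))
    (Expansion.flags-expand (expansion true T P B (trans (flags-word true T (1<leaves-𝒯 {n} T∈)) w≡)))
  into : ∀ {T} → T ∈ filter w●∪w○? (𝒯 n) → expand i T ∈ treesWith (suc n) w●○
  into {T} T∈ with T∈𝒯 , w≡ ← ∈-filter⁻ w●∪w○? {xs = 𝒯 n} T∈ =
    ∈-filter⁺ (word≟ w●○) (∈-𝒯⁺ {suc n} (trans (leaves-expand i T) (cong suc (∈-𝒯⁻ {n} T∈𝒯))))
      (case w≡ of λ where
        (inj₁ e) → word-expand T∈𝒯 e
        (inj₂ e) → word-expand T∈𝒯 e)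
  onto : ∀ {T} → T ∈ treesWith (suc n) w●○ → ∃[ T′ ] T′ ∈ filter w●∪w○? (𝒯 n) × T ≡ expand i T′
  onto {T} T∈ with T∈𝒯 , w≡ ← ∈-treesWith⁻ {suc n} T∈
       with T′ , x , refl , flags≡ ← expand-surjective true T P B
                                       (trans (flags-word true T (1<leaves-𝒯 {suc n} T∈𝒯)) w≡) =
    T′ , ∈-filter⁺ w●∪w○? T′∈𝒯 (choose x word≡) , refl
    where
    T′∈𝒯 : T′ ∈ 𝒯 n
    T′∈𝒯 = ∈-𝒯⁺ {n} (ℕ.suc-injective (trans (sym (leaves-expand i T′)) (∈-𝒯⁻ {suc n} T∈𝒯)))
    word≡ = trans (sym (flags-word true T′ (1<leaves-𝒯 {n} T′∈𝒯))) flags≡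
    choose : ∀ x → word T′ ≡ P ++ x ∷ B → word T′ ≡ w● ⊎ word T′ ≡ w○
    choose true  = inj₁
    choose false = inj₂

treesWith-○∷ : ∀ n w → treesWith n (false ∷ w) ≡ []
treesWith-○∷ n w = filter-none (word≟ (false ∷ w)) {xs = 𝒯 n}
  (All.tabulate (λ _ e → contradiction (∷-injectiveˡ e) λ ()))

treesWith-∷ʳ● : ∀ n w → treesWith n (w ++ true ∷ []) ≡ []
treesWith-∷ʳ● n w = filter-none (word≟ (w ++ true ∷ [])) {xs = 𝒯 n}
  (All.tabulate (λ {T} _ e → contradiction (∷ʳ-injectiveʳ (true ∷ R T) w e) λ ()))

factor : List Bool → ℚ → ℚ
factor P q = if null P then q else 1ℚ

factor-++-∷ : ∀ v {x w} q → factor (v ++ x ∷ w) q ≡ 1ℚ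
factor-++-∷ []      q = refl
factor-++-∷ (_ ∷ _) q = refl

^-sucIfNull : ∀ q P k → q ^ (sucIfNull P (suc k) ∸ 1) ≡ factor P q * q ^ k
^-sucIfNull q []      k = refl
^-sucIfNull q (_ ∷ _) k = sym (*-identityˡ (q ^ k))

module _ (α β : ℚ) where

  μ-expand : ∀ l r P {x} B → flags true (node l r) ≡ P ++ x ∷ B →
    μ α β (expand (length P) (node l r)) ≡ factor P (inv α) * (factor B (inv β) * μ α β (node l r))
  μ-expand l r P B e = begin
    μ α β (expand (length P) (node l r))
      ≡⟨ cong₂ (λ p q → inv α ^ (p ∸ 1) * inv β ^ (q ∸ 1)) depthL-expand depthR-expand ⟩
    inv α ^ (sucIfNull P (suc (depthL l)) ∸ 1) * inv β ^ (sucIfNull B (suc (depthR r)) ∸ 1)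
      ≡⟨ cong₂ _*_ (^-sucIfNull (inv α) P (depthL l)) (^-sucIfNull (inv β) B (depthR r)) ⟩
    (factor P (inv α) * inv α ^ depthL l) * (factor B (inv β) * inv β ^ depthR r)
      ≡⟨ solve 4 (λ a A b B → (a :* A) :* (b :* B) := a :* (b :* (A :* B))) refl
           (factor P (inv α)) (inv α ^ depthL l) (factor B (inv β)) (inv β ^ depthR r) ⟩
    factor P (inv α) * (factor B (inv β) * μ α β (node l r)) ∎
    where open Expansion (expansion true (node l r) P B e)

  Σ-μ-expand : ∀ n P x B →
    Σ[ treesWith n (P ++ x ∷ B) ] (μ α β ∘ expand (length P))
      ≡ factor P (inv α) * (factor B (inv β) * Σ[ treesWith n (P ++ x ∷ B) ] μ α β)
  Σ-μ-expand n P x B = begin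
    Σ[ Ts ] (μ α β ∘ expand (length P))                   ≡⟨ Σ-cong-∈ Ts pointwise ⟩
    Σ[ Ts ] (λ T → factor P (inv α) * (factor B (inv β) * μ α β T))
      ≡⟨ *-distribˡ-Σ (factor P (inv α)) Ts (λ T → factor B (inv β) * μ α β T) ⟨
    factor P (inv α) * Σ[ Ts ] (λ T → factor B (inv β) * μ α β T)
      ≡⟨ cong (factor P (inv α) *_) (*-distribˡ-Σ (factor B (inv β)) Ts (μ α β)) ⟨
    factor P (inv α) * (factor B (inv β) * Σ[ Ts ] μ α β) ∎
    where
    Ts = treesWith n (P ++ x ∷ B)
    pointwise : ∀ {T} → T ∈ Ts → μ α β (expand (length P) T) ≡ factor P (inv α) * (factor B (inv β) * μ α β T)
    pointwise {leaf}     T∈ = contradiction (1<leaves-𝒯 {n} (proj₁ (∈-treesWith⁻ {n} T∈))) λ { (ℕ.s≤s ()) }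
    pointwise {node l r} T∈ = μ-expand l r P B (trans (flags-node true l r) (proj₂ (∈-treesWith⁻ {n} T∈)))

  weightOf : List Bool → ℚ
  weightOf v = Σ[ filter (λ T → ≡-dec Bool._≟_ (R T) v) (𝒯 (length v)) ] μ α β

  weightOf-treesWith : ∀ v {n w} → length v ≡ n → bracket v ≡ w → weightOf v ≡ Σ[ treesWith n w ] μ α β
  weightOf-treesWith v refl refl = cong (λ Ts → Σ[ Ts ] μ α β)
    (filter-≐ (λ T → ≡-dec Bool._≟_ (R T) v) (word≟ (bracket v)) (cong bracket , bracket-injective)
              (𝒯 (length v)))

  weightOf-left : LeftRelation (inv α) weightOf
  weightOf-left v = begin
    weightOf (false ∷ v)
      ≡⟨ weightOf-treesWith (false ∷ v) refl refl ⟩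
    Σ[ treesWith (suc n) ([] ++ true ∷ false ∷ B) ] μ α β
      ≡⟨ Σ-treesWith-expand n [] B (μ α β) ⟩
    Σ[ treesWith n (bracket v) ] (μ α β ∘ expand 0) + Σ[ treesWith n (false ∷ B) ] (μ α β ∘ expand 0)
      ≡⟨ cong₂ _+_ (Σ-μ-expand n [] true B) (cong (λ Ts → Σ[ Ts ] (μ α β ∘ expand 0)) (treesWith-○∷ n B)) ⟩
    inv α * (factor B (inv β) * S) + 0ℚ
      ≡⟨ +-identityʳ _ ⟩
    inv α * (factor B (inv β) * S)
      ≡⟨ cong (λ q → inv α * (q * S)) (factor-++-∷ v (inv β)) ⟩
    inv α * (1ℚ * S)
      ≡⟨ cong (inv α *_) (trans (*-identityˡ S) (sym (weightOf-treesWith v refl refl))) ⟩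
    inv α * weightOf v ∎
    where
    n = length v
    B = v ++ false ∷ []
    S = Σ[ treesWith n (bracket v) ] μ α β

  weightOf-right : RightRelation (inv β) weightOf
  weightOf-right v = begin
    weightOf (v ++ true ∷ [])
      ≡⟨ weightOf-treesWith (v ++ true ∷ []) (length-++-comm v (true ∷ [])) (bracket-++ v true []) ⟩
    Σ[ treesWith (suc n) (P ++ true ∷ false ∷ []) ] μ α β
      ≡⟨ Σ-treesWith-expand n P [] (μ α β) ⟩
    Σ[ treesWith n (P ++ true ∷ []) ] (μ α β ∘ expand (suc n))
      + Σ[ treesWith n (bracket v) ] (μ α β ∘ expand (suc n))
      ≡⟨ cong₂ _+_ (cong (λ Ts → Σ[ Ts ] (μ α β ∘ expand (suc n))) (treesWith-∷ʳ● n P))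
                   (Σ-μ-expand n P false []) ⟩
    0ℚ + 1ℚ * (inv β * S)
      ≡⟨ trans (+-identityˡ _) (*-identityˡ _) ⟩
    inv β * S
      ≡⟨ cong (inv β *_) (weightOf-treesWith v refl refl) ⟨
    inv β * weightOf v ∎
    where
    n = length v
    P = true ∷ v
    S = Σ[ treesWith n (bracket v) ] μ α β

  weightOf-bulk : BulkRelation weightOf
  weightOf-bulk u v = begin
    weightOf (u ++ true ∷ false ∷ v)
      ≡⟨ weightOf-treesWith (u ++ true ∷ false ∷ v) (length-++-sucʳ u true (false ∷ v))
                            (bracket-++ u true (false ∷ v)) ⟩
    Σ[ treesWith (suc n) (P ++ true ∷ false ∷ B) ] μ α β
      ≡⟨ Σ-treesWith-expand n P B (μ α β) ⟩
    Σ[ treesWith n (P ++ true ∷ B) ] (μ α β ∘ expand (length P))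
      + Σ[ treesWith n (P ++ false ∷ B) ] (μ α β ∘ expand (length P))
      ≡⟨ cong₂ _+_ (Σ-μ-expand n P true B) (Σ-μ-expand n P false B) ⟩
    1ℚ * (factor B (inv β) * S●) + 1ℚ * (factor B (inv β) * S○)
      ≡⟨ cong₂ _+_ (unit S●) (unit S○) ⟩
    S● + S○
      ≡⟨ cong₂ _+_ (weightOf-treesWith (u ++ true ∷ v) length● (bracket-++ u true v))
                   (weightOf-treesWith (u ++ false ∷ v) refl (bracket-++ u false v)) ⟨
    weightOf (u ++ true ∷ v) + weightOf (u ++ false ∷ v) ∎
    where
    n = length (u ++ false ∷ v)
    P = true ∷ u
    B = v ++ false ∷ []
    S● = Σ[ treesWith n (P ++ true ∷ B) ] μ α β
    S○ = Σ[ treesWith n (P ++ false ∷ B) ] μ α β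
    length● : length (u ++ true ∷ v) ≡ n
    length● = trans (length-++-sucʳ u true v) (sym (length-++-sucʳ u false v))
    unit : ∀ S → 1ℚ * (factor B (inv β) * S) ≡ S
    unit S = trans (*-identityˡ _) (trans (cong (_* S) (factor-++-∷ v (inv β))) (*-identityˡ S))

  weightOf-matrixAnsatz : MatrixAnsatz (inv α) (inv β) weightOf
  weightOf-matrixAnsatz = record { bulk = weightOf-bulk ; left = weightOf-left ; right = weightOf-right }

*-inv : ∀ {q} → 0ℚ < q → q * inv q ≡ 1ℚ
*-inv {q} 0<q with q ≟ 0ℚ
... | yes q≡0 = contradiction (sym q≡0) (<⇒≢ 0<q)
... | no  q≢0 = *-inverseʳ q {{≢-nonZero q≢0}}

Σ-allConfigs : ∀ {n} (C : Config n) (F : List Bool → ℚ) →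
  Σ[ allConfigs n ] (F ∘ toList) ≡ ΣConfig (length (toList C)) F
Σ-allConfigs {n} C F rewrite length-toList C = sym (Σ-map toList (allConfigs n) F)

proposition1 : (n : ℕ) → n ≥ 1 → (α β : ℚ) → 0ℚ < α → α ≤ 1ℚ → 0ℚ < β → β ≤ 1ℚ →
    (C : Config n) →
      Pst α β C * (Σ[ allConfigs n ] (λ C' → W α β C C'))
        ≡ Σ[ allConfigs n ] (λ C' → Pst α β C' * W α β C' C)
proposition1 n _ α β 0<α _ 0<β _ C = begin
  Pst α β C * Σ[ allConfigs n ] (W α β C)
    ≡⟨ cong₂ _*_ (Pst≡ C) (Σ-allConfigs C (rate α β c)) ⟩
  g c * ΣConfig (length c) (rate α β c)
    ≡⟨ cong (g c *_) (ΣConfig-rate-from α β c) ⟩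
  g c * outRate α β c
    ≡⟨ balance {α} {β} (*-inv 0<α) (*-inv 0<β) (MatrixAnsatz-scale k (weightOf-matrixAnsatz α β)) c ⟩
  inflow α β g c
    ≡⟨ ΣConfig-rate-into α β g c ⟨
  ΣConfig (length c) (λ l → g l * rate α β l c)
    ≡⟨ Σ-allConfigs C (λ l → g l * rate α β l c) ⟨
  Σ[ allConfigs n ] (λ C′ → g (toList C′) * W α β C′ C)
    ≡⟨ Σ-cong (allConfigs n) (λ C′ → cong (_* W α β C′ C) (Pst≡ C′)) ⟨
  Σ[ allConfigs n ] (λ C′ → Pst α β C′ * W α β C′ C) ∎
  where
  c = toList C
  k = inv (Z α β n)
  g : List Bool → ℚ
  g w = k * weightOf α β w
  Pst≡ : ∀ (C : Config n) → Pst α β C ≡ g (toList C)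
  Pst≡ C = cong (λ m → k * Σ[ filter (λ T → ≡-dec Bool._≟_ (R T) (toList C)) (𝒯 m) ] μ α β)
                (sym (length-toList C))
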